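{- There is a finitary existential formula $\psi(u,v,u',v',x,y)$ in the language of groups such that for every field $F$ and any two non-commuting pairs $(u,v)$ and $(u',v')$ in $H(F)$, $\psi(u,v,u',v',x,y)$ defines (the graph of) the isomorphism $f_{(u,v),(u',v')}:F_{(u,v)}\to F_{(u',v')}$.
   Context: For a field $F$, $H(F)$ is the group under matrix multiplication of all matrices $h(a,b,c)=\begin{pmatrix}1&a&c\\0&1&b\\0&0&1\end{pmatrix}$, $a,b,c\in F$, with center $Z(H(F))=\{h(0,0,c):c\in F\}$. Commutators are $[x,y]=x^{ -1}y^{ -1}xy$. For $u=h(u_1,u_2,u_3)$, $v=h(v_1,v_2,v_3)$ put $\Delta_{(u,v)}=u_1v_2-v_1u_2$; $u,v$ commute iff $\Delta_{(u,v)}=0$. For a non-commuting pair $(u,v)$, $F_{(u,v)}$ is the field $(Z(H(F)),\oplus,\otimes_{(u,v)})$, where $\oplus$ is group multiplication and $\otimes_{(u,v)}$ consists of the triples $(x,y,z)$ of central elements for which there exist $x',y'$ with $[x',u]=[y',v]=1$, $[x',v]=x$, $[u,y']=y$, $[x',y']=z$; the map $g_{(u,v)}:\alpha\mapsto h(0,0,\alpha\Delta_{(u,v)})$ is an isomorphism $F\to F_{(u,v)}$. For non-commuting pairs $(u,v),(u',v')$, $f_{(u,v),(u',v')}=g_{(u',v')}\circ g_{(u,v)}^{ -1}$, i.e. $f_{(u,v),(u',v')}(h(0,0,\alpha\Delta_{(u,v)}))=h(0,0,\alpha\Delta_{(u',v')})$. -}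

module Defs where

open import Level using (Level; _⊔_; suc)
open import Agda.Primitive using (Setω)
open import Data.Nat using (ℕ) renaming (_+_ to _+ℕ_)
open import Data.Fin using (Fin)
open import Data.Product using (Σ; ∃; _×_; _,_)
open import Data.Sum using (_⊎_)
open import Data.Vec.Functional using (Vector; _++_; [];  _∷_)
open import Relation.Nullary using (¬_)
open import Function.Bundles using (_⇔_)
open import Algebra.Bundles using (CommutativeRing)

record Field (c ℓ : Level) : Set (Level.suc (c ⊔ ℓ)) where
  field
    commutativeRing : CommutativeRing c ℓ
  open CommutativeRing commutativeRing public
  field
    0≉1     : ¬ (0# ≈ 1#)
    inverse : ∀ x → ¬ (x ≈ 0#) → ∃ λ y → x * y ≈ 1#

data Term (n : ℕ) : Set where
  var  : Fin n → Term n
  e    : Term n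
  _·_  : Term n → Term n → Term n
  _⁻¹  : Term n → Term n

data QF (n : ℕ) : Set where
  _≐_  : Term n → Term n → QF n
  ⊤'   : QF n
  ⊥'   : QF n
  ¬'_  : QF n → QF n
  _∧'_ : QF n → QF n → QF n
  _∨'_ : QF n → QF n → QF n

-- a finitary existential formula with n free variables:
-- ∃ z₁ … z_k . φ(x₁,…,x_n,z₁,…,z_k) with φ quantifier-free
record ExFormula (n : ℕ) : Set where
  constructor ∃[_]_
  field
    nbound : ℕ
    body   : QF (n +ℕ nbound)

-- The Heisenberg group H(F): h(a,b,c) represented by the triple (a,b,c);
-- matrix multiplication gives
--   h(a,b,c) h(a',b',c') = h(a+a', b+b', c+c'+a b'),
--   h(a,b,c)⁻¹ = h(-a,-b,-c+ab).

module Heisenberg {c ℓ : Level} (F : Field c ℓ) where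
  open Field F

  record H : Set c where
    constructor h
    field
      h₁ h₂ h₃ : Carrier
  open H public

  _≈H_ : H → H → Set ℓ
  x ≈H y = (h₁ x ≈ h₁ y) × (h₂ x ≈ h₂ y) × (h₃ x ≈ h₃ y)

  _∙H_ : H → H → H
  h a b d ∙H h a' b' d' = h (a + a') (b + b') (d + d' + a * b')

  invH : H → H
  invH (h a b d) = h (- a) (- b) (- d + a * b)

  1H : H
  1H = h 0# 0# 0#

  Commute : H → H → Set ℓ
  Commute x y = (x ∙H y) ≈H (y ∙H x)

  Central : H → Set (c ⊔ ℓ)
  Central z = ∀ w → Commute z w

  Δ : H → H → Carrier
  Δ u v = h₁ u * h₂ v - h₁ v * h₂ u

  g : H → H → Carrier → H
  g u v α = h 0# 0# (α * Δ u v)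

  -- the graph of f_(u,v),(u',v') = g_(u',v') ∘ g_(u,v)⁻¹ : F_(u,v) → F_(u',v')
  GraphF : (u v u' v' x y : H) → Set (c ⊔ ℓ)
  GraphF u v u' v' x y = ∃ λ α → (x ≈H g u v α) × (y ≈H g u' v' α)

  ⟦_⟧t : ∀ {n} → Term n → Vector H n → H
  ⟦ var i ⟧t  ρ = ρ i
  ⟦ e ⟧t      ρ = 1H
  ⟦ s · t ⟧t  ρ = ⟦ s ⟧t ρ ∙H ⟦ t ⟧t ρ
  ⟦ t ⁻¹ ⟧t   ρ = invH (⟦ t ⟧t ρ)

  data ⊤ℓ : Set ℓ where
    tt : ⊤ℓ
  data ⊥ℓ : Set ℓ where

  ⟦_⟧qf : ∀ {n} → QF n → Vector H n → Set ℓ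
  ⟦ s ≐ t ⟧qf  ρ = ⟦ s ⟧t ρ ≈H ⟦ t ⟧t ρ
  ⟦ ⊤' ⟧qf     ρ = ⊤ℓ
  ⟦ ⊥' ⟧qf     ρ = ⊥ℓ
  ⟦ ¬' φ ⟧qf   ρ = ¬ ⟦ φ ⟧qf ρ
  ⟦ φ ∧' χ ⟧qf ρ = ⟦ φ ⟧qf ρ × ⟦ χ ⟧qf ρ
  ⟦ φ ∨' χ ⟧qf ρ = ⟦ φ ⟧qf ρ ⊎ ⟦ χ ⟧qf ρ

  _⊨_[] : ∀ {n} → ExFormula n → Vector H n → Set (c ⊔ ℓ)
  (∃[ k ] φ) ⊨ ρ [] = Σ (Vector H k) λ σ → ⟦ φ ⟧qf (ρ ++ σ)

-- dependent pair whose second component lives in Setω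
-- (needed to quantify over fields of all universe levels)

record Σω (A : Set) (P : A → Setω) : Setω where
  constructor _,ω_
  field
    witness  : A
    property : P witness

module Submission where

-- The graph of f_(u,v),(u',v') is defined in H(F), uniformly in F, by
--
--   ψ(u,v,u',v',x,y) :≡ ∃ x' y'. [x',u] = e ∧ [y',v] = e ∧ [x',v] = x
--                                ∧ [u,y'] = [u',v'] ∧ [x',y'] = y.
--
-- Everything rests on the commutator formula [s,t] = h(0,0,Δ_(s,t)): it
-- turns each conjunct of ψ into an equation between determinants Δ.
-- Soundness: with α := Δ_(x',v) / Δ_(u,v) we get x = g_(u,v)(α), and the
-- Plücker relation Δ_(x',y') Δ_(u,v) = Δ_(x',v) Δ_(u,y') + Δ_(x',u) Δ_(y',v)
-- together with the other conjuncts gives Δ_(x',y') = α Δ_(u',v'), i.e.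
-- y = g_(u',v')(α).  Completeness: for x = g_(u,v)(α) the witnesses are
-- x' := α·u and y' := κ·v with κ Δ_(u,v) = Δ_(u',v'), where r·s scales the
-- first two coordinates of s; Δ is bilinear and alternating.

open import Defs
open import Level using (Level)
open import Data.Nat as ℕ using (ℕ)
open import Data.Fin using (zero; suc)
open import Data.Product using (_,_; _×_; ∃; proj₁; proj₂)
open import Data.Maybe using (Maybe; just; nothing)
open import Data.Vec.Functional using ([]; _∷_)
open import Relation.Nullary using (¬_; yes; no)
open import Relation.Binary.PropositionalEquality using (_≡_) renaming (refl to ≡-refl)
open import Function.Bundles using (_⇔_; mk⇔)
open import Algebra.Bundles using (CommutativeRing; RawRing)
import Algebra.Solver.Ring.AlmostCommutativeRing as AlmostCommutativeRing
import Algebra.Solver.Ring as RingSolver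

-- The ring solver for an arbitrary commutative ring R, with coefficients
-- the integers represented as differences a - b of naturals in normal
-- form (a = 0 or b = 0), mapped into R by a - b ↦ a·1 - b·1.  Normal forms
-- make equality of coefficients decidable by syntactic comparison.
module IntegerCoefficientSolver {c ℓ : Level} (R : CommutativeRing c ℓ) where
  open CommutativeRing R
  open import Algebra.Properties.Ring ring using (-‿+-comm; [y-z]x≈yx-zx; x[y-z]≈xy-xz)
  open import Algebra.Properties.AbelianGroup +-abelianGroup using (xyx⁻¹≈y; ⁻¹-anti-homo‿-)
  open import Algebra.Properties.Semiring.Mult semiring using (×-homo-+; ×1-homo-*)
    renaming (_×_ to _×ᵣ_)
  open import Relation.Binary.Reasoning.Setoid setoid

  ι : ℕ → Carrier
  ι n = n ×ᵣ 1#

  Difference : Set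
  Difference = ℕ × ℕ

  ⟦_⟧ : Difference → Carrier
  ⟦ a , b ⟧ = ι a - ι b

  normalise : ℕ → ℕ → Difference
  normalise (ℕ.suc a) (ℕ.suc b) = normalise a b
  normalise a b = a , b

  +-cancel-difference : ∀ o a b → (o + a) - (o + b) ≈ a - b
  +-cancel-difference o a b = begin
    (o + a) + - (o + b)   ≈⟨ +-congˡ (sym (-‿+-comm o b)) ⟩
    (o + a) + (- o + - b) ≈⟨ sym (+-assoc (o + a) (- o) (- b)) ⟩
    ((o + a) + - o) + - b ≈⟨ +-congʳ (xyx⁻¹≈y o a) ⟩
    a + - b               ∎

  normalise-sound : ∀ a b → ⟦ normalise a b ⟧ ≈ ι a - ι b
  normalise-sound ℕ.zero    b         = refl
  normalise-sound (ℕ.suc a) ℕ.zero    = refl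
  normalise-sound (ℕ.suc a) (ℕ.suc b) =
    trans (normalise-sound a b) (sym (+-cancel-difference 1# (ι a) (ι b)))

  difference-+ : ∀ a b c d → (a + c) - (b + d) ≈ (a - b) + (c - d)
  difference-+ a b c d = begin
    (a + c) + - (b + d)   ≈⟨ +-congˡ (sym (-‿+-comm b d)) ⟩
    (a + c) + (- b + - d) ≈⟨ +-assoc a c (- b + - d) ⟩
    a + (c + (- b + - d)) ≈⟨ +-congˡ (sym (+-assoc c (- b) (- d))) ⟩
    a + ((c + - b) + - d) ≈⟨ +-congˡ (+-congʳ (+-comm c (- b))) ⟩
    a + ((- b + c) + - d) ≈⟨ +-congˡ (+-assoc (- b) c (- d)) ⟩
    a + (- b + (c + - d)) ≈⟨ sym (+-assoc a (- b) (c + - d)) ⟩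
    (a + - b) + (c + - d) ∎

  difference-* : ∀ a b c d → (a * c + b * d) - (a * d + b * c) ≈ (a - b) * (c - d)
  difference-* a b c d = sym (begin
    (a - b) * (c - d)                 ≈⟨ [y-z]x≈yx-zx (c - d) a b ⟩
    a * (c - d) - b * (c - d)         ≈⟨ +-cong (x[y-z]≈xy-xz a c d) (-‿cong (x[y-z]≈xy-xz b c d)) ⟩
    (a * c - a * d) - (b * c - b * d) ≈⟨ +-congˡ (⁻¹-anti-homo‿- (b * c) (b * d)) ⟩
    (a * c - a * d) + (b * d - b * c) ≈⟨ sym (difference-+ (a * c) (a * d) (b * d) (b * c)) ⟩
    (a * c + b * d) - (a * d + b * c) ∎)

  Coefficients : RawRing _ _
  Coefficients = record
    { Carrier = Difference
    ; _≈_     = _≡_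
    ; _+_     = λ { (a , b) (c , d) → normalise (a ℕ.+ c) (b ℕ.+ d) }
    ; _*_     = λ { (a , b) (c , d) → normalise (a ℕ.* c ℕ.+ b ℕ.* d) (a ℕ.* d ℕ.+ b ℕ.* c) }
    ; -_      = λ { (a , b) → b , a }
    ; 0#      = 0 , 0
    ; 1#      = 1 , 0
    }

  homomorphism : Coefficients AlmostCommutativeRing.-Raw-AlmostCommutative⟶
                 AlmostCommutativeRing.fromCommutativeRing R
  homomorphism = record
    { ⟦_⟧    = ⟦_⟧
    ; +-homo = λ { (a , b) (c , d) → begin
        ⟦ normalise (a ℕ.+ c) (b ℕ.+ d) ⟧ ≈⟨ normalise-sound (a ℕ.+ c) (b ℕ.+ d) ⟩
        ι (a ℕ.+ c) - ι (b ℕ.+ d)         ≈⟨ +-cong (×-homo-+ 1# a c) (-‿cong (×-homo-+ 1# b d)) ⟩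
        (ι a + ι c) - (ι b + ι d)         ≈⟨ difference-+ (ι a) (ι b) (ι c) (ι d) ⟩
        (ι a - ι b) + (ι c - ι d)         ∎ }
    ; *-homo = λ { (a , b) (c , d) → begin
        ⟦ normalise (a ℕ.* c ℕ.+ b ℕ.* d) (a ℕ.* d ℕ.+ b ℕ.* c) ⟧
          ≈⟨ normalise-sound (a ℕ.* c ℕ.+ b ℕ.* d) (a ℕ.* d ℕ.+ b ℕ.* c) ⟩
        ι (a ℕ.* c ℕ.+ b ℕ.* d) - ι (a ℕ.* d ℕ.+ b ℕ.* c)
          ≈⟨ +-cong (trans (×-homo-+ 1# (a ℕ.* c) (b ℕ.* d)) (+-cong (×1-homo-* a c) (×1-homo-* b d)))
                    (-‿cong (trans (×-homo-+ 1# (a ℕ.* d) (b ℕ.* c)) (+-cong (×1-homo-* a d) (×1-homo-* b c)))) ⟩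
        (ι a * ι c + ι b * ι d) - (ι a * ι d + ι b * ι c)
          ≈⟨ difference-* (ι a) (ι b) (ι c) (ι d) ⟩
        (ι a - ι b) * (ι c - ι d) ∎ }
    ; -‿homo = λ { (a , b) → sym (⁻¹-anti-homo‿- (ι a) (ι b)) }
    ; 0-homo = -‿inverseʳ 0#
    ; 1-homo = trans (+-assoc 1# 0# (- 0#)) (trans (+-congˡ (-‿inverseʳ 0#)) (+-identityʳ 1#))
    }

  compare : ∀ x y → Maybe (⟦ x ⟧ ≈ ⟦ y ⟧)
  compare (a , b) (c , d) with a ℕ.≟ c | b ℕ.≟ d
  ... | yes ≡-refl | yes ≡-refl = just refl
  ... | _          | _          = nothing

  open RingSolver Coefficients (AlmostCommutativeRing.fromCommutativeRing R) homomorphism compare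
    public using (solve; _:=_; _:+_; _:*_; _:-_; :-_; con)

module Division {c ℓ : Level} (F : Field c ℓ) where
  open Field F
  open import Algebra.Properties.CommutativeSemigroup *-commutativeSemigroup using (xy∙z≈xz∙y)
  open import Relation.Binary.Reasoning.Setoid setoid

  *-inverse-cancel : ∀ {d r} → d * r ≈ 1# → ∀ a → (a * d) * r ≈ a
  *-inverse-cancel {d} {r} dr≈1 a = begin
    (a * d) * r ≈⟨ *-assoc a d r ⟩
    a * (d * r) ≈⟨ *-congˡ dr≈1 ⟩
    a * 1#      ≈⟨ *-identityʳ a ⟩
    a           ∎

  quotient : ∀ {d} → ¬ (d ≈ 0#) → ∀ a → ∃ λ q → q * d ≈ a
  quotient {d} d≉0 a with inverse d d≉0
  ... | r , dr≈1 = a * r , (begin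
    (a * r) * d ≈⟨ xy∙z≈xz∙y a r d ⟩
    (a * d) * r ≈⟨ *-inverse-cancel dr≈1 a ⟩
    a           ∎)

  *-cancelʳ : ∀ {d} → ¬ (d ≈ 0#) → ∀ {a b} → a * d ≈ b * d → a ≈ b
  *-cancelʳ {d} d≉0 {a} {b} ad≈bd with inverse d d≉0
  ... | r , dr≈1 = begin
    a           ≈⟨ sym (*-inverse-cancel dr≈1 a) ⟩
    (a * d) * r ≈⟨ *-congʳ ad≈bd ⟩
    (b * d) * r ≈⟨ *-inverse-cancel dr≈1 b ⟩
    b           ∎

module HeisenbergFacts {c ℓ : Level} (F : Field c ℓ) where
  open Field F
  open Heisenberg F
  open IntegerCoefficientSolver commutativeRing
  open import Algebra.Properties.Group +-group using (x∙y⁻¹≈ε⇒x≈y)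
  open import Relation.Binary.Reasoning.Setoid setoid

  ≈H-sym : ∀ {x y} → x ≈H y → y ≈H x
  ≈H-sym (p , q , r) = sym p , sym q , sym r

  ≈H-trans : ∀ {x y z} → x ≈H y → y ≈H z → x ≈H z
  ≈H-trans (p , q , r) (p' , q' , r') = trans p p' , trans q q' , trans r r'

  central : Carrier → H
  central a = h 0# 0# a

  central-cong : ∀ {a b} → a ≈ b → central a ≈H central b
  central-cong a≈b = refl , refl , a≈b

  central-injective : ∀ {a b} → central a ≈H central b → a ≈ b
  central-injective (_ , _ , a≈b) = a≈b

  _·ₕ_ : Carrier → H → H
  r ·ₕ s = h (r * h₁ s) (r * h₂ s) 0#

  Δ-alternating : ∀ s → Δ s s ≈ 0#
  Δ-alternating s = -‿inverseʳ (h₁ s * h₂ s)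

  Δ-scaleˡ : ∀ r s t → Δ (r ·ₕ s) t ≈ r * Δ s t
  Δ-scaleˡ r (h s₁ s₂ _) (h t₁ t₂ _) =
    solve 5 (λ r s₁ s₂ t₁ t₂ → (r :* s₁) :* t₂ :- t₁ :* (r :* s₂) := r :* (s₁ :* t₂ :- t₁ :* s₂))
      refl r s₁ s₂ t₁ t₂

  Δ-scaleʳ : ∀ r s t → Δ s (r ·ₕ t) ≈ r * Δ s t
  Δ-scaleʳ r (h s₁ s₂ _) (h t₁ t₂ _) =
    solve 5 (λ r s₁ s₂ t₁ t₂ → s₁ :* (r :* t₂) :- (r :* t₁) :* s₂ := r :* (s₁ :* t₂ :- t₁ :* s₂))
      refl r s₁ s₂ t₁ t₂

  Δ-scale-self : ∀ r s → Δ (r ·ₕ s) s ≈ 0#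
  Δ-scale-self r s = begin
    Δ (r ·ₕ s) s ≈⟨ Δ-scaleˡ r s s ⟩
    r * Δ s s    ≈⟨ *-congˡ (Δ-alternating s) ⟩
    r * 0#       ≈⟨ zeroʳ r ⟩
    0#           ∎

  Δ-plücker : ∀ a b s t → Δ a b * Δ s t ≈ Δ a t * Δ s b + Δ a s * Δ b t
  Δ-plücker (h a₁ a₂ _) (h b₁ b₂ _) (h s₁ s₂ _) (h t₁ t₂ _) =
    solve 8 (λ a₁ a₂ b₁ b₂ s₁ s₂ t₁ t₂ →
      (a₁ :* b₂ :- b₁ :* a₂) :* (s₁ :* t₂ :- t₁ :* s₂) :=
      (a₁ :* t₂ :- t₁ :* a₂) :* (s₁ :* b₂ :- b₁ :* s₂) :+ (a₁ :* s₂ :- s₁ :* a₂) :* (b₁ :* t₂ :- t₁ :* b₂))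
      refl a₁ a₂ b₁ b₂ s₁ s₂ t₁ t₂

  -- the commutator [s,t] = s⁻¹t⁻¹st, exactly as the term language computes it
  ⁅_,_⁆ : H → H → H
  ⁅ s , t ⁆ = ((invH s ∙H invH t) ∙H s) ∙H t

  commutator : ∀ s t → ⁅ s , t ⁆ ≈H central (Δ s t)
  commutator (h s₁ s₂ s₃) (h t₁ t₂ t₃) = outer s₁ t₁ , outer s₂ t₂ ,
    solve 6 (λ s₁ s₂ s₃ t₁ t₂ t₃ →
      (:- s₃ :+ s₁ :* s₂) :+ (:- t₃ :+ t₁ :* t₂) :+ (:- s₁) :* (:- t₂) :+ s₃
        :+ (:- s₁ :+ :- t₁) :* s₂ :+ t₃ :+ (:- s₁ :+ :- t₁ :+ s₁) :* t₂
      := s₁ :* t₂ :- t₁ :* s₂)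
      refl s₁ s₂ s₃ t₁ t₂ t₃
    where
    outer : ∀ a b → ((- a + - b) + a) + b ≈ 0#
    outer a b = trans
      (solve 2 (λ a b → ((:- a :+ :- b) :+ a) :+ b := con (0 , 0)) refl a b)
      (-‿inverseʳ 0#)

  commutator-value : ∀ {s t w} → ⁅ s , t ⁆ ≈H w → w ≈H central (Δ s t)
  commutator-value {s} {t} st≈w = ≈H-trans (≈H-sym st≈w) (commutator s t)

  commutator-from-value : ∀ {s t w} → w ≈H central (Δ s t) → ⁅ s , t ⁆ ≈H w
  commutator-from-value {s} {t} w≈ = ≈H-trans (commutator s t) (≈H-sym w≈)

  Δ≈0⇒commute : ∀ s t → Δ s t ≈ 0# → Commute s t
  Δ≈0⇒commute (h s₁ s₂ s₃) (h t₁ t₂ t₃) Δ≈0 =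
    +-comm s₁ t₁ , +-comm s₂ t₂ , +-cong (+-comm s₃ t₃) (x∙y⁻¹≈ε⇒x≈y (s₁ * t₂) (t₁ * s₂) Δ≈0)

  noncommuting⇒Δ≉0 : ∀ {s t} → ¬ Commute s t → ¬ (Δ s t ≈ 0#)
  noncommuting⇒Δ≉0 {s} {t} ¬st Δ≈0 = ¬st (Δ≈0⇒commute s t Δ≈0)

module GraphFormula where
  ⁅_,_⁆ₜ : ∀ {n} → Term n → Term n → Term n
  ⁅ s , t ⁆ₜ = (((s ⁻¹) · (t ⁻¹)) · s) · t

  u v u' v' x y x' y' : Term 8
  u  = var zero
  v  = var (suc zero)
  u' = var (suc (suc zero))
  v' = var (suc (suc (suc zero)))
  x  = var (suc (suc (suc (suc zero))))
  y  = var (suc (suc (suc (suc (suc zero)))))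
  x' = var (suc (suc (suc (suc (suc (suc zero))))))
  y' = var (suc (suc (suc (suc (suc (suc (suc zero)))))))

  ψ : ExFormula 6
  ψ = ∃[ 2 ] ((⁅ x' , u ⁆ₜ ≐ e) ∧' ((⁅ y' , v ⁆ₜ ≐ e) ∧' ((⁅ x' , v ⁆ₜ ≐ x) ∧'
             ((⁅ u , y' ⁆ₜ ≐ ⁅ u' , v' ⁆ₜ) ∧' (⁅ x' , y' ⁆ₜ ≐ y)))))

module GraphFormulaCorrect {c ℓ : Level} (F : Field c ℓ) where
  open Field F hiding (zero)
  open Heisenberg F
  open HeisenbergFacts F
  open Division F
  open GraphFormula using (ψ)
  open import Algebra.Properties.CommutativeSemigroup *-commutativeSemigroup using (xy∙z≈xz∙y)
  open import Relation.Binary.Reasoning.Setoid setoid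

  -- the witnesses x', y' force x = g_(u,v)(α) and y = g_(u',v')(α) for
  -- α = Δ_(x',v) / Δ_(u,v)
  soundness : ∀ u v u' v' x y → ¬ Commute u v →
              ψ ⊨ (u ∷ v ∷ u' ∷ v' ∷ x ∷ y ∷ []) [] → GraphF u v u' v' x y
  soundness u v u' v' x y ¬uv (σ , [x',u]≈e , _ , [x',v]≈x , [u,y']≈[u',v'] , [x',y']≈y) =
    α , ≈H-trans x≈ (central-cong (sym αD≈Δx'v)) , ≈H-trans y≈ (central-cong Δx'y'≈αD')
    where
    x' y' : H
    x' = σ zero
    y' = σ (suc zero)
    D≉0 : ¬ (Δ u v ≈ 0#)
    D≉0 = noncommuting⇒Δ≉0 ¬uv
    α-spec : ∃ λ α → α * Δ u v ≈ Δ x' v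
    α-spec = quotient D≉0 (Δ x' v)
    α : Carrier
    α = proj₁ α-spec
    αD≈Δx'v : α * Δ u v ≈ Δ x' v
    αD≈Δx'v = proj₂ α-spec
    x≈ : x ≈H central (Δ x' v)
    x≈ = commutator-value [x',v]≈x
    y≈ : y ≈H central (Δ x' y')
    y≈ = commutator-value [x',y']≈y
    Δx'u≈0 : Δ x' u ≈ 0#
    Δx'u≈0 = sym (central-injective (commutator-value [x',u]≈e))
    Δuy'≈D' : Δ u y' ≈ Δ u' v'
    Δuy'≈D' = central-injective
      (≈H-trans (≈H-sym (commutator u y')) (≈H-trans [u,y']≈[u',v'] (commutator u' v')))
    Δx'y'≈αD' : Δ x' y' ≈ α * Δ u' v'
    Δx'y'≈αD' = *-cancelʳ D≉0 (begin
      Δ x' y' * Δ u v                     ≈⟨ Δ-plücker x' y' u v ⟩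
      Δ x' v * Δ u y' + Δ x' u * Δ y' v   ≈⟨ +-cong (*-congˡ Δuy'≈D') (*-congʳ Δx'u≈0) ⟩
      Δ x' v * Δ u' v' + 0# * Δ y' v      ≈⟨ +-congˡ (zeroˡ (Δ y' v)) ⟩
      Δ x' v * Δ u' v' + 0#               ≈⟨ +-identityʳ _ ⟩
      Δ x' v * Δ u' v'                    ≈⟨ *-congʳ (sym αD≈Δx'v) ⟩
      (α * Δ u v) * Δ u' v'               ≈⟨ xy∙z≈xz∙y α (Δ u v) (Δ u' v') ⟩
      (α * Δ u' v') * Δ u v               ∎)

  completeness : ∀ u v u' v' x y → ¬ Commute u v →
                 GraphF u v u' v' x y → ψ ⊨ (u ∷ v ∷ u' ∷ v' ∷ x ∷ y ∷ []) []
  completeness u v u' v' x y ¬uv (α , x≈ , y≈) =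
    (x' ∷ y' ∷ []) ,
    commutator-from-value (central-cong (sym (Δ-scale-self α u))) ,
    commutator-from-value (central-cong (sym (Δ-scale-self κ v))) ,
    commutator-from-value (≈H-trans x≈ (central-cong (sym (Δ-scaleˡ α u v)))) ,
    ≈H-trans (commutator u y') (≈H-trans (central-cong Δuy'≈D') (≈H-sym (commutator u' v'))) ,
    commutator-from-value (≈H-trans y≈ (central-cong (sym Δx'y'≈αD')))
    where
    κ-spec : ∃ λ κ → κ * Δ u v ≈ Δ u' v'
    κ-spec = quotient (noncommuting⇒Δ≉0 ¬uv) (Δ u' v')
    κ : Carrier
    κ = proj₁ κ-spec
    x' y' : H
    x' = α ·ₕ u
    y' = κ ·ₕ v
    Δuy'≈D' : Δ u y' ≈ Δ u' v'
    Δuy'≈D' = trans (Δ-scaleʳ κ u v) (proj₂ κ-spec)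
    Δx'y'≈αD' : Δ x' y' ≈ α * Δ u' v'
    Δx'y'≈αD' = trans (Δ-scaleˡ α u y') (*-congˡ Δuy'≈D')

lemma3p2 : Σω (ExFormula 6) λ ψ →
    ∀ {c ℓ : Level} (F : Field c ℓ) → let open Heisenberg F in
    (u v u' v' : H) → ¬ Commute u v → ¬ Commute u' v' →
    (x y : H) →
    (ψ ⊨ (u ∷ v ∷ u' ∷ v' ∷ x ∷ y ∷ []) []) ⇔ GraphF u v u' v' x y
lemma3p2 = GraphFormula.ψ ,ω λ F u v u' v' ¬uv _ x y →
  let open GraphFormulaCorrect F in
  mk⇔ (soundness u v u' v' x y ¬uv) (completeness u v u' v' x y ¬uv)
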